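{- Let $a_1,\dots,a_s$ be non-zero natural numbers and let $\tilde A_1,\dots,\tilde A_t$ be finite non-empty subsets of $\mathbb{N}$ with $\min\tilde A_i=0$ for all $i$. Let $\tilde S$ be the sumset semigroup generated by $\{a_1\},\dots,\{a_s\},\tilde A_1,\dots,\tilde A_t$, with ideal $I_{\tilde S}\subset\mathbf{k}[x_1,\dots,x_s,y_1,\dots,y_t]$ where $x_i$ corresponds to $\{a_i\}$ and $y_j$ to $\tilde A_j$. Then $$I_{\tilde S}=I_{\langle a_1,\ldots,a_s\rangle}+I_{\langle\tilde A_1,\ldots,\tilde A_t\rangle},$$ where $I_{\langle a_1,\ldots,a_s\rangle}\subset\mathbf{k}[x_1,\dots,x_s]$ is the ideal of the sumset semigroup generated by $\{a_1\},\dots,\{a_s\}$ (equivalently, of the numerical semigroup-type monoid $\langle a_1,\dots,a_s\rangle\subset\mathbb{N}$ with generators $a_1,\dots,a_s$) and $I_{\langle\tilde A_1,\ldots,\tilde A_t\rangle}\subset\mathbf{k}[y_1,\dots,y_t]$ is the ideal of the sumset semigroup generated by $\tilde A_1,\dots,\tilde A_t$, both extended to $\mathbf{k}[x_1,\dots,x_s,y_1,\dots,y_t]$.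
   Context: $\mathrm{FS}(\mathbb{N})$ is the set of finite non-empty subsets of $\mathbb{N}$ with operation $A+B=\{a+b\mid a\in A,b\in B\}$ and identity $\{0\}$; $\alpha\otimes A$ denotes the $\alpha$-fold sum of $A$ with itself ($0\otimes A=\{0\}$). A sumset semigroup is a finitely generated submonoid of $\mathrm{FS}(\mathbb{N})$. For a field $\mathbf{k}$ and a list of generators $A_1,\dots,A_t$ of a sumset semigroup $S$, its ideal is the binomial ideal $I_S\subset\mathbf{k}[x_1,\dots,x_t]$ generated by all $x_1^{\alpha_1}\cdots x_t^{\alpha_t}-x_1^{\beta_1}\cdots x_t^{\beta_t}$ with $\sum_i\alpha_i\otimes A_i=\sum_i\beta_i\otimes A_i$ (sums taken in $\mathrm{FS}(\mathbb{N})$). -}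

module Defs where

open import Level using (Level; _⊔_) renaming (suc to lsuc)
open import Data.Nat as ℕ using (ℕ; zero; suc; _⊓_)
open import Data.Product using (Σ; ∃; ∃-syntax; _×_; _,_)
open import Data.Sum using (_⊎_)
open import Data.List as L using (List; []; _∷_; _++_; concatMap)
open import Data.List.NonEmpty as L⁺ using (List⁺; _∷_; toList; [_])
open import Data.List.Membership.Propositional using (_∈_)
open import Data.Vec as V using (Vec; []; _∷_; zipWith; replicate)
open import Data.Vec.Properties using (≡-dec)
open import Relation.Nullary using (¬_; yes; no)
open import Relation.Binary.PropositionalEquality using (_≡_)
open import Algebra.Bundles using (CommutativeRing)

record Field (c ℓ : Level) : Set (lsuc (c ⊔ ℓ)) where
  field
    commRing : CommutativeRing c ℓ
  open CommutativeRing commRing public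
  field
    1≉0     : ¬ (1# ≈ 0#)
    inverse : ∀ x → ¬ (x ≈ 0#) → ∃[ y ] (x * y ≈ 1#)

-- FS(ℕ): finite non-empty subsets of ℕ, represented by non-empty lists
-- (duplicates/order irrelevant), compared by having the same elements.

FS : Set
FS = List⁺ ℕ

_≃ₛ_ : FS → FS → Set
A ≃ₛ B = ∀ x → (x ∈ toList A → x ∈ toList B) × (x ∈ toList B → x ∈ toList A)

minFS : FS → ℕ
minFS = L⁺.foldr₁ _⊓_

_⊕_ : FS → FS → FS
(a ∷ as) ⊕ B = L⁺.concatMap (λ x → L⁺.map (x ℕ.+_) B) (a ∷ as)

𝟘 : FS
𝟘 = [ 0 ]

_⊗_ : ℕ → FS → FS
zero  ⊗ A = 𝟘
suc α ⊗ A = A ⊕ (α ⊗ A)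

lincomb : ∀ {n} → Vec ℕ n → Vec FS n → FS
lincomb []       []       = 𝟘
lincomb (α ∷ αs) (A ∷ As) = (α ⊗ A) ⊕ lincomb αs As

module Polynomials {c ℓ} (k : Field c ℓ) where
  open Field k

  Monomial : ℕ → Set
  Monomial n = Vec ℕ n

  Poly : ℕ → Set c
  Poly n = List (Carrier × Monomial n)

  coeff : ∀ {n} → Poly n → Monomial n → Carrier
  coeff []             m = 0#
  coeff ((a , μ) ∷ p) m with ≡-dec ℕ._≟_ μ m
  ... | yes _ = a + coeff p m
  ... | no  _ = coeff p m

  _≋_ : ∀ {n} → Poly n → Poly n → Set ℓ
  p ≋ q = ∀ m → coeff p m ≈ coeff q m

  _+ₚ_ : ∀ {n} → Poly n → Poly n → Poly n
  p +ₚ q = p ++ q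

  _*ₚ_ : ∀ {n} → Poly n → Poly n → Poly n
  p *ₚ q = concatMap (λ { (a , μ) → L.map (λ { (b , ν) → (a * b , zipWith ℕ._+_ μ ν) }) q }) p

  binom : ∀ {n} → Monomial n → Monomial n → Poly n
  binom α β = (1# , α) ∷ (- 1# , β) ∷ []

  data ⟨_⟩ {n g} (G : Poly n → Set g) : Poly n → Set (c ⊔ ℓ ⊔ g) where
    zero-∈  : ⟨ G ⟩ []
    add-∈   : ∀ {p} → ⟨ G ⟩ p → (r q : Poly n) → G q → ⟨ G ⟩ (p +ₚ (r *ₚ q))
    resp-∈  : ∀ {p q} → p ≋ q → ⟨ G ⟩ p → ⟨ G ⟩ q

  _≐_ : ∀ {n i j} → (Poly n → Set i) → (Poly n → Set j) → Set (c ⊔ i ⊔ j)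
  I ≐ J = ∀ p → (I p → J p) × (J p → I p)

  _⊞_ : ∀ {n i j} → (Poly n → Set i) → (Poly n → Set j) → Poly n → Set (c ⊔ ℓ ⊔ i ⊔ j)
  I ⊞ J = ⟨ (λ p → I p ⊎ J p) ⟩

  mapPoly : ∀ {m n} → (Monomial m → Monomial n) → Poly m → Poly n
  mapPoly f = L.map (λ { (a , μ) → (a , f μ) })

  extend : ∀ {m n i} → (Monomial m → Monomial n) → (Poly m → Set i) → Poly n → Set (c ⊔ ℓ ⊔ i)
  extend f I = ⟨ (λ p → ∃[ q ] (I q × p ≡ mapPoly f q)) ⟩

  sumsetIdeal : ∀ {n} → Vec FS n → Poly n → Set (c ⊔ ℓ)
  sumsetIdeal As = ⟨ (λ p → ∃[ α ] ∃[ β ] (lincomb α As ≃ₛ lincomb β As × p ≡ binom α β)) ⟩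

  inclˡ : ∀ {s} t → Monomial s → Monomial (s ℕ.+ t)
  inclˡ t α = α V.++ replicate t 0

  inclʳ : ∀ s {t} → Monomial t → Monomial (s ℕ.+ t)
  inclʳ s β = replicate s 0 V.++ β

{-# OPTIONS --safe #-}
module Submission where

-- Write a monomial of k[x,y] as x^α y^γ. Every Σ γⱼ ⊗ Ãⱼ contains 0 because min Ãⱼ = 0, whereas
-- Σ αᵢ ⊗ {aᵢ} is a singleton {m}. From {m} + B = {n} + C with 0 ∈ B, C one reads off m = n (the
-- least elements agree) and then B = C (translate back by m). Hence a relation of S̃ splits into a
-- relation among the aᵢ and one among the Ãⱼ, and the telescoping identity
--   x^α y^γ − x^β y^δ = y^γ (x^α − x^β) + x^β (y^γ − y^δ)
-- puts each generator of I_S̃ into the sum of the two extended ideals. Conversely, padding a relation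
-- with zero exponents gives a relation of S̃, so both extended ideals lie in I_S̃.

open import Defs
open import Level using (Level)
open import Data.Nat using (ℕ; NonZero)
open import Data.Product using (∃-syntax; _×_; _,_; proj₁; proj₂)
open import Data.Sum using (inj₁; inj₂)
open import Function using (_∘_)
open import Data.List as L using ([]; _∷_)
import Data.List.Properties as L
open import Data.List.NonEmpty using (_∷_; toList; [_])
open import Data.Vec as V using (Vec; []; _∷_; map; _++_; replicate)
open import Data.Vec.Relation.Unary.All using (All; []; _∷_)
open import Relation.Binary.Bundles using (Setoid)
import Relation.Binary.Reasoning.Setoid as SetoidReasoning
open import Relation.Binary.PropositionalEquality as ≡ using (_≡_; refl; cong; subst)

module Sumsets where

  open import Data.Nat using (zero; suc; _+_; _*_; _≤_)
  open import Data.Nat.Properties using (+-identityʳ; +-assoc; +-cancelˡ-≡; ≤-antisym; m≤m+n; ⊓-sel)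
  open import Data.List.Membership.Propositional using (_∈_; find)
  open import Data.List.Membership.Propositional.Properties
    using (∈-map⁺; ∈-map⁻; ∈-concatMap⁺; ∈-concatMap⁻)
  open import Data.List.Relation.Unary.Any as Any using (here; there)
  open ≡ using (sym)

  ≃ₛ-setoid : Setoid _ _
  ≃ₛ-setoid = record
    { Carrier       = FS
    ; _≈_           = _≃ₛ_
    ; isEquivalence = record
      { refl  = λ _ → (λ x∈ → x∈) , (λ x∈ → x∈)
      ; sym   = λ A≃B x → proj₂ (A≃B x) , proj₁ (A≃B x)
      ; trans = λ A≃B B≃C x → (λ x∈ → proj₁ (B≃C x) (proj₁ (A≃B x) x∈))
                             , (λ x∈ → proj₂ (A≃B x) (proj₂ (B≃C x) x∈))
      }
    }

  open Setoid ≃ₛ-setoid public using () renaming (refl to ≃ₛ-refl; sym to ≃ₛ-sym)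
  module ≃ₛ-Reasoning = SetoidReasoning ≃ₛ-setoid

  toList-⊕ : ∀ A B → toList (A ⊕ B) ≡ L.concatMap (λ x → L.map (x +_) (toList B)) (toList A)
  toList-⊕ (a ∷ as) (b ∷ bs) =
    cong (λ z → a + b ∷ L.map (a +_) bs L.++ L.concat z) (sym (L.map-∘ as))

  ∈-⊕⁺ : ∀ {A B a b} → a ∈ toList A → b ∈ toList B → a + b ∈ toList (A ⊕ B)
  ∈-⊕⁺ {A} {B} {a} a∈A b∈B rewrite toList-⊕ A B =
    ∈-concatMap⁺ (λ x → L.map (x +_) (toList B)) (Any.map (λ { refl → ∈-map⁺ (a +_) b∈B }) a∈A)

  ∈-⊕⁻ : ∀ A B {x} → x ∈ toList (A ⊕ B) → ∃[ a ] ∃[ b ] (a ∈ toList A × b ∈ toList B × x ≡ a + b)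
  ∈-⊕⁻ A B x∈A⊕B rewrite toList-⊕ A B with find (∈-concatMap⁻ (λ x → L.map (x +_) (toList B)) x∈A⊕B)
  ... | a , a∈A , x∈a+B with ∈-map⁻ (a +_) x∈a+B
  ...   | b , b∈B , x≡a+b = a , b , a∈A , b∈B , x≡a+b

  ⊕-cong : ∀ {A A′ B B′} → A ≃ₛ A′ → B ≃ₛ B′ → (A ⊕ B) ≃ₛ (A′ ⊕ B′)
  ⊕-cong {A} {A′} {B} {B′} A≃A′ B≃B′ x = transport A≃A′ B≃B′ , transport (≃ₛ-sym A≃A′) (≃ₛ-sym B≃B′)
    where
    transport : ∀ {C C′ D D′} → C ≃ₛ C′ → D ≃ₛ D′ → x ∈ toList (C ⊕ D) → x ∈ toList (C′ ⊕ D′)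
    transport {C} {D = D} C≃C′ D≃D′ x∈ with ∈-⊕⁻ C D x∈
    ... | c , d , c∈C , d∈D , refl = ∈-⊕⁺ (proj₁ (C≃C′ c) c∈C) (proj₁ (D≃D′ d) d∈D)

  ⊕-identityˡ : ∀ A → (𝟘 ⊕ A) ≃ₛ A
  ⊕-identityˡ A x = from , ∈-⊕⁺ {𝟘} (here refl)
    where
    from : x ∈ toList (𝟘 ⊕ A) → x ∈ toList A
    from x∈ with ∈-⊕⁻ 𝟘 A x∈
    ... | .0 , b , here refl , b∈A , refl = b∈A

  ⊕-assoc : ∀ A B C → ((A ⊕ B) ⊕ C) ≃ₛ (A ⊕ (B ⊕ C))
  ⊕-assoc A B C x = to , from
    where
    to : x ∈ toList ((A ⊕ B) ⊕ C) → x ∈ toList (A ⊕ (B ⊕ C))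
    to x∈ with ∈-⊕⁻ (A ⊕ B) C x∈
    ... | _ , c , ab∈ , c∈C , refl with ∈-⊕⁻ A B ab∈
    ...   | a , b , a∈A , b∈B , refl =
      subst (_∈ toList (A ⊕ (B ⊕ C))) (sym (+-assoc a b c)) (∈-⊕⁺ a∈A (∈-⊕⁺ {B} b∈B c∈C))
    from : x ∈ toList (A ⊕ (B ⊕ C)) → x ∈ toList ((A ⊕ B) ⊕ C)
    from x∈ with ∈-⊕⁻ A (B ⊕ C) x∈
    ... | a , _ , a∈A , bc∈ , refl with ∈-⊕⁻ B C bc∈
    ...   | b , c , b∈B , c∈C , refl =
      subst (_∈ toList ((A ⊕ B) ⊕ C)) (+-assoc a b c) (∈-⊕⁺ {A ⊕ B} (∈-⊕⁺ {A} a∈A b∈B) c∈C)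

  lincomb-++ : ∀ {m n} (α : Vec ℕ m) (γ : Vec ℕ n) As Bs →
    lincomb (α ++ γ) (As ++ Bs) ≃ₛ (lincomb α As ⊕ lincomb γ Bs)
  lincomb-++ []      γ []       Bs = ≃ₛ-sym (⊕-identityˡ (lincomb γ Bs))
  lincomb-++ (a ∷ α) γ (A ∷ As) Bs = begin
    (a ⊗ A) ⊕ lincomb (α ++ γ) (As ++ Bs)   ≈⟨ ⊕-cong (≃ₛ-refl {a ⊗ A}) (lincomb-++ α γ As Bs) ⟩
    (a ⊗ A) ⊕ (lincomb α As ⊕ lincomb γ Bs) ≈⟨ ≃ₛ-sym (⊕-assoc (a ⊗ A) (lincomb α As) (lincomb γ Bs)) ⟩
    ((a ⊗ A) ⊕ lincomb α As) ⊕ lincomb γ Bs ∎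
    where open ≃ₛ-Reasoning

  lincomb-++-cong : ∀ {m n} (α β : Vec ℕ m) (γ δ : Vec ℕ n) As Bs →
    lincomb α As ≃ₛ lincomb β As → lincomb γ Bs ≃ₛ lincomb δ Bs →
    lincomb (α ++ γ) (As ++ Bs) ≃ₛ lincomb (β ++ δ) (As ++ Bs)
  lincomb-++-cong α β γ δ As Bs α≃β γ≃δ = begin
    lincomb (α ++ γ) (As ++ Bs)   ≈⟨ lincomb-++ α γ As Bs ⟩
    lincomb α As ⊕ lincomb γ Bs   ≈⟨ ⊕-cong α≃β γ≃δ ⟩
    lincomb β As ⊕ lincomb δ Bs   ≈⟨ ≃ₛ-sym (lincomb-++ β δ As Bs) ⟩
    lincomb (β ++ δ) (As ++ Bs)   ∎
    where open ≃ₛ-Reasoning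

  ⊗-singleton : ∀ α x → (α ⊗ [ x ]) ≃ₛ [ α * x ]
  ⊗-singleton zero    x = ≃ₛ-refl {𝟘}
  ⊗-singleton (suc α) x = ⊕-cong (≃ₛ-refl {[ x ]}) (⊗-singleton α x)

  lincomb-singletons : ∀ {n} (α a : Vec ℕ n) → ∃[ m ] (lincomb α (map [_] a) ≃ₛ [ m ])
  lincomb-singletons []      []      = 0 , ≃ₛ-refl {𝟘}
  lincomb-singletons (α ∷ αs) (a ∷ as) with lincomb-singletons αs as
  ... | m , αs·as≃m = α * a + m , ⊕-cong (⊗-singleton α a) αs·as≃m

  minFS∈ : ∀ x xs → minFS (x ∷ xs) ∈ x ∷ xs
  minFS∈ x []       = here refl
  minFS∈ x (y ∷ ys) with ⊓-sel x (minFS (y ∷ ys))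
  ... | inj₁ min≡x = here min≡x
  ... | inj₂ min≡m = there (subst (_∈ y ∷ ys) (sym min≡m) (minFS∈ y ys))

  0∈⊗ : ∀ α A → 0 ∈ toList A → 0 ∈ toList (α ⊗ A)
  0∈⊗ zero    A 0∈A = here refl
  0∈⊗ (suc α) A 0∈A = ∈-⊕⁺ {A} 0∈A (0∈⊗ α A 0∈A)

  0∈lincomb : ∀ {n} (α : Vec ℕ n) {As : Vec FS n} → All (λ A → minFS A ≡ 0) As →
    0 ∈ toList (lincomb α As)
  0∈lincomb []      []                    = here refl
  0∈lincomb (a ∷ α) {A ∷ _} (minA≡0 ∷ mins) =
    ∈-⊕⁺ {a ⊗ A} (0∈⊗ a A (subst (_∈ toList A) minA≡0 (minFS∈ _ _))) (0∈lincomb α mins)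

  singleton-⊕-cancel : ∀ {m n B C} → 0 ∈ toList B → 0 ∈ toList C →
    ([ m ] ⊕ B) ≃ₛ ([ n ] ⊕ C) → m ≡ n × B ≃ₛ C
  singleton-⊕-cancel {m} {n} {B} {C} 0∈B 0∈C m+B≃n+C =
    m≡n , λ x → shift m+B≃n+C m≡n x , shift (≃ₛ-sym m+B≃n+C) (sym m≡n) x
    where
    lower : ∀ {m n B C} → 0 ∈ toList B → ([ m ] ⊕ B) ≃ₛ ([ n ] ⊕ C) → n ≤ m
    lower {m} {n} {B} {C} 0∈B m+B≃n+C
      with ∈-⊕⁻ [ n ] C (proj₁ (m+B≃n+C m)
             (subst (_∈ toList ([ m ] ⊕ B)) (+-identityʳ m) (∈-⊕⁺ {[ m ]} (here refl) 0∈B)))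
    ... | .n , c , here refl , _ , m≡n+c = subst (n ≤_) (sym m≡n+c) (m≤m+n n c)
    m≡n : m ≡ n
    m≡n = ≤-antisym (lower 0∈C (≃ₛ-sym m+B≃n+C)) (lower 0∈B m+B≃n+C)
    shift : ∀ {m n B C} → ([ m ] ⊕ B) ≃ₛ ([ n ] ⊕ C) → m ≡ n → ∀ x → x ∈ toList B → x ∈ toList C
    shift {m} {B = B} {C} m+B≃n+C refl x x∈B
      with ∈-⊕⁻ [ m ] C (proj₁ (m+B≃n+C (m + x)) (∈-⊕⁺ {[ m ]} (here refl) x∈B))
    ... | .m , c , here refl , c∈C , m+x≡m+c = subst (_∈ toList C) (sym (+-cancelˡ-≡ m x c m+x≡m+c)) c∈C

  lincomb-split : ∀ {s t} (a : Vec ℕ s) {Ã : Vec FS t} → All (λ A → minFS A ≡ 0) Ã →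
    ∀ α₁ β₁ {α₂ β₂} →
    lincomb (α₁ ++ α₂) (map [_] a ++ Ã) ≃ₛ lincomb (β₁ ++ β₂) (map [_] a ++ Ã) →
    lincomb α₁ (map [_] a) ≃ₛ lincomb β₁ (map [_] a) × lincomb α₂ Ã ≃ₛ lincomb β₂ Ã
  lincomb-split a {Ã} mins α₁ β₁ {α₂} {β₂} α≃β
    with lincomb-singletons α₁ a | lincomb-singletons β₁ a
  ... | m , α₁≃m | n , β₁≃n = α₁≃β₁ , α₂≃β₂
    where
    open ≃ₛ-Reasoning
    m+α₂≃n+β₂ : ([ m ] ⊕ lincomb α₂ Ã) ≃ₛ ([ n ] ⊕ lincomb β₂ Ã)
    m+α₂≃n+β₂ = begin
      [ m ] ⊕ lincomb α₂ Ã                    ≈⟨ ⊕-cong (≃ₛ-sym α₁≃m) (≃ₛ-refl {lincomb α₂ Ã}) ⟩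
      lincomb α₁ (map [_] a) ⊕ lincomb α₂ Ã   ≈⟨ ≃ₛ-sym (lincomb-++ α₁ α₂ (map [_] a) Ã) ⟩
      lincomb (α₁ ++ α₂) (map [_] a ++ Ã)     ≈⟨ α≃β ⟩
      lincomb (β₁ ++ β₂) (map [_] a ++ Ã)     ≈⟨ lincomb-++ β₁ β₂ (map [_] a) Ã ⟩
      lincomb β₁ (map [_] a) ⊕ lincomb β₂ Ã   ≈⟨ ⊕-cong β₁≃n (≃ₛ-refl {lincomb β₂ Ã}) ⟩
      [ n ] ⊕ lincomb β₂ Ã                    ∎
    cancelled = singleton-⊕-cancel (0∈lincomb α₂ mins) (0∈lincomb β₂ mins) m+α₂≃n+β₂
    α₂≃β₂ = proj₂ cancelled
    α₁≃β₁ : lincomb α₁ (map [_] a) ≃ₛ lincomb β₁ (map [_] a)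
    α₁≃β₁ = begin
      lincomb α₁ (map [_] a) ≈⟨ α₁≃m ⟩
      [ m ]                  ≡⟨ cong [_] (proj₁ cancelled) ⟩
      [ n ]                  ≈⟨ ≃ₛ-sym β₁≃n ⟩
      lincomb β₁ (map [_] a) ∎

open Sumsets

module PolynomialIdeals {c ℓ : Level} (k : Field c ℓ) where

  import Data.Nat as Nat
  import Data.Nat.Properties as Nat
  open import Data.Vec using (zipWith)
  open import Data.Vec.Properties
    using ( ≡-dec; zipWith-identityˡ; zipWith-identityʳ; zipWith-assoc; zipWith-++
          ; ++-injectiveˡ; ++-injectiveʳ; take++drop≡id )
  open import Data.List.Relation.Binary.Pointwise as Pointwise using (Pointwise; []; _∷_)
  open import Relation.Nullary using (¬_; yes; no)
  open import Relation.Nullary.Negation using (contradiction)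
  open import Algebra.Definitions using (Congruent₁)
  open Field k renaming (refl to ≈-refl)
  open Polynomials k

  infixl 6 _+ᵐ_
  _+ᵐ_ : ∀ {n} → Monomial n → Monomial n → Monomial n
  _+ᵐ_ = zipWith Nat._+_

  ≋-setoid : ℕ → Setoid c ℓ
  ≋-setoid n = record
    { Carrier       = Poly n
    ; _≈_           = _≋_
    ; isEquivalence = record
      { refl  = λ _ → ≈-refl
      ; sym   = λ p≋q m → sym (p≋q m)
      ; trans = λ p≋q q≋r m → trans (p≋q m) (q≋r m)
      }
    }

  module ≋-Reasoning {n} = SetoidReasoning (≋-setoid n)

  coeff-++ : ∀ {n} (p q : Poly n) m → coeff (p L.++ q) m ≈ coeff p m + coeff q m
  coeff-++ []            q m = sym (+-identityˡ _)
  coeff-++ ((a , μ) ∷ p) q m with ≡-dec Nat._≟_ μ m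
  ... | yes _ = trans (+-congˡ (coeff-++ p q m)) (sym (+-assoc _ _ _))
  ... | no  _ = coeff-++ p q m

  ++-cong : ∀ {n} (p p′ q q′ : Poly n) → p ≋ p′ → q ≋ q′ → (p L.++ q) ≋ (p′ L.++ q′)
  ++-cong p p′ q q′ p≋p′ q≋q′ m =
    trans (coeff-++ p q m) (trans (+-cong (p≋p′ m) (q≋q′ m)) (sym (coeff-++ p′ q′ m)))

  ∷-cong : ∀ {n} t {p q : Poly n} → p ≋ q → (t ∷ p) ≋ (t ∷ q)
  ∷-cong (a , μ) p≋q m with ≡-dec Nat._≟_ μ m
  ... | yes _ = +-congˡ (p≋q m)
  ... | no  _ = p≋q m

  ∷-∷-cancel : ∀ {n} {a b} (μ : Monomial n) p → a + b ≈ 0# → ((a , μ) ∷ (b , μ) ∷ p) ≋ p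
  -- The test in the second coeff only becomes visible after the first one is decided, hence two withs.
  ∷-∷-cancel {a = a} {b} μ p a+b≈0 m with ≡-dec Nat._≟_ μ m
  ... | yes μ≡m with ≡-dec Nat._≟_ μ m
  ...   | yes _   = trans (sym (+-assoc a b _)) (trans (+-congʳ a+b≈0) (+-identityˡ _))
  ...   | no μ≢m  = contradiction μ≡m μ≢m
  ∷-∷-cancel μ p a+b≈0 m | no μ≢m with ≡-dec Nat._≟_ μ m
  ...   | yes μ≡m = contradiction μ≡m μ≢m
  ...   | no _    = ≈-refl

  Term : ℕ → Set c
  Term n = Carrier × Monomial n

  mapTerms : ∀ {m n} → (Carrier → Carrier) → (Monomial m → Monomial n) → Poly m → Poly n
  mapTerms h f = L.map λ { (b , ν) → h b , f ν }

  infixr 7 _·ₜ_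
  _·ₜ_ : ∀ {n} → Term n → Poly n → Poly n
  (a , μ) ·ₜ q = mapTerms (a *_) (μ +ᵐ_) q

  -- The left inverse g of f is only used to decide whether a monomial lies in the image of f.
  module _ {m n} {h : Carrier → Carrier} {f : Monomial m → Monomial n} (g : Monomial n → Monomial m)
           (h-cong : Congruent₁ _≈_ h) (h-+ : ∀ x y → h (x + y) ≈ h x + h y) (h-0 : h 0# ≈ 0#)
           (g∘f : ∀ μ → g (f μ) ≡ μ) where

    coeff-mapTerms-image : ∀ p μ → coeff (mapTerms h f p) (f μ) ≈ h (coeff p μ)
    coeff-mapTerms-image []            μ = sym h-0
    coeff-mapTerms-image ((b , ν) ∷ p) μ with ≡-dec Nat._≟_ (f ν) (f μ) | ≡-dec Nat._≟_ ν μ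
    ... | yes _     | yes _   = trans (+-congˡ (coeff-mapTerms-image p μ)) (sym (h-+ _ _))
    ... | yes fν≡fμ | no ν≢μ  =
      contradiction (≡.trans (≡.sym (g∘f ν)) (≡.trans (cong g fν≡fμ) (g∘f μ))) ν≢μ
    ... | no fν≢fμ  | yes ν≡μ = contradiction (cong f ν≡μ) fν≢fμ
    ... | no _      | no _    = coeff-mapTerms-image p μ

    coeff-mapTerms-outside : ∀ p m → (∀ μ → ¬ f μ ≡ m) → coeff (mapTerms h f p) m ≈ 0#
    coeff-mapTerms-outside []            m m∉f = ≈-refl
    coeff-mapTerms-outside ((b , ν) ∷ p) m m∉f with ≡-dec Nat._≟_ (f ν) m
    ... | yes fν≡m = contradiction fν≡m (m∉f ν)
    ... | no _     = coeff-mapTerms-outside p m m∉f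

    mapTerms-cong : ∀ p q → p ≋ q → mapTerms h f p ≋ mapTerms h f q
    mapTerms-cong p q p≋q m with ≡-dec Nat._≟_ (f (g m)) m
    ... | yes fgm≡m = subst (λ m → coeff (mapTerms h f p) m ≈ coeff (mapTerms h f q) m) fgm≡m
                        (trans (coeff-mapTerms-image p (g m))
                          (trans (h-cong (p≋q (g m))) (sym (coeff-mapTerms-image q (g m)))))
    ... | no fgm≢m = trans (coeff-mapTerms-outside p m m∉f) (sym (coeff-mapTerms-outside q m m∉f))
      where
      m∉f : ∀ μ → ¬ f μ ≡ m
      m∉f μ refl = fgm≢m (cong f (g∘f μ))

  +ᵐ-cancelsˡ : ∀ {n} (μ ν : Monomial n) → zipWith Nat._∸_ (μ +ᵐ ν) μ ≡ ν
  +ᵐ-cancelsˡ []      []      = refl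
  +ᵐ-cancelsˡ (x ∷ μ) (y ∷ ν) = ≡.cong₂ _∷_ (Nat.m+n∸m≡n x y) (+ᵐ-cancelsˡ μ ν)

  ·ₜ-congˡ : ∀ {n} (t : Term n) q q′ → q ≋ q′ → (t ·ₜ q) ≋ (t ·ₜ q′)
  ·ₜ-congˡ (a , μ) =
    mapTerms-cong (λ ν → zipWith Nat._∸_ ν μ) *-congˡ (distribˡ a) (zeroʳ a) (+ᵐ-cancelsˡ μ)

  _≈ₜ_ : ∀ {n} → Term n → Term n → Set ℓ
  (a , μ) ≈ₜ (b , ν) = a ≈ b × μ ≡ ν

  Pointwise⇒≋ : ∀ {n} {p q : Poly n} → Pointwise _≈ₜ_ p q → p ≋ q
  Pointwise⇒≋ []                              m = ≈-refl
  Pointwise⇒≋ {p = (_ , μ) ∷ _} ((a≈b , refl) ∷ p≈q) m with ≡-dec Nat._≟_ μ m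
  ... | yes _ = +-cong a≈b (Pointwise⇒≋ p≈q m)
  ... | no  _ = Pointwise⇒≋ p≈q m

  ·ₜ-identityˡ : ∀ {n} (p : Poly n) → Pointwise _≈ₜ_ ((1# , replicate n 0) ·ₜ p) p
  ·ₜ-identityˡ []            = []
  ·ₜ-identityˡ ((b , ν) ∷ p) = (*-identityˡ b , zipWith-identityˡ Nat.+-identityˡ ν) ∷ ·ₜ-identityˡ p

  *ₚ-zeroʳ : ∀ {n} (r : Poly n) → r *ₚ [] ≡ []
  *ₚ-zeroʳ []            = refl
  *ₚ-zeroʳ ((a , μ) ∷ r) = *ₚ-zeroʳ r

  *ₚ-distribʳ : ∀ {n} (p q r : Poly n) → (p L.++ q) *ₚ r ≡ p *ₚ r L.++ q *ₚ r
  *ₚ-distribʳ p q r = L.concatMap-++ _ p q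

  *ₚ-congˡ : ∀ {n} (r q q′ : Poly n) → q ≋ q′ → (r *ₚ q) ≋ (r *ₚ q′)
  *ₚ-congˡ []      q q′ q≋q′ _ = ≈-refl
  *ₚ-congˡ (t ∷ r) q q′ q≋q′ =
    ++-cong (t ·ₜ q) (t ·ₜ q′) (r *ₚ q) (r *ₚ q′) (·ₜ-congˡ t q q′ q≋q′) (*ₚ-congˡ r q q′ q≋q′)

  *ₚ-distribˡ : ∀ {n} (r p q : Poly n) → (r *ₚ (p L.++ q)) ≋ (r *ₚ p L.++ r *ₚ q)
  *ₚ-distribˡ []      p q _ = ≈-refl
  *ₚ-distribˡ (t ∷ r) p q m = begin
    coeff (t ·ₜ (p L.++ q) L.++ r *ₚ (p L.++ q)) m
      ≈⟨ coeff-++ (t ·ₜ (p L.++ q)) _ m ⟩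
    coeff (t ·ₜ (p L.++ q)) m + coeff (r *ₚ (p L.++ q)) m
      ≡⟨ cong (λ z → coeff z m + _) (L.map-++ _ p q) ⟩
    coeff (t ·ₜ p L.++ t ·ₜ q) m + coeff (r *ₚ (p L.++ q)) m
      ≈⟨ +-cong (coeff-++ (t ·ₜ p) _ m) (trans (*ₚ-distribˡ r p q m) (coeff-++ (r *ₚ p) _ m)) ⟩
    (coeff (t ·ₜ p) m + coeff (t ·ₜ q) m) + (coeff (r *ₚ p) m + coeff (r *ₚ q) m)
      ≈⟨ +-interchange _ _ _ _ ⟩
    (coeff (t ·ₜ p) m + coeff (r *ₚ p) m) + (coeff (t ·ₜ q) m + coeff (r *ₚ q) m)
      ≈⟨ sym (+-cong (coeff-++ (t ·ₜ p) _ m) (coeff-++ (t ·ₜ q) _ m)) ⟩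
    coeff ((t ∷ r) *ₚ p) m + coeff ((t ∷ r) *ₚ q) m
      ≈⟨ sym (coeff-++ ((t ∷ r) *ₚ p) _ m) ⟩
    coeff ((t ∷ r) *ₚ p L.++ (t ∷ r) *ₚ q) m ∎
    where
    open SetoidReasoning setoid
    open import Algebra.Properties.CommutativeSemigroup +-commutativeSemigroup
      using () renaming (interchange to +-interchange)

  ·ₜ-assoc : ∀ {n} a b (μ ν : Monomial n) q →
    Pointwise _≈ₜ_ ((a , μ) ·ₜ (b , ν) ·ₜ q) ((a * b , μ +ᵐ ν) ·ₜ q)
  ·ₜ-assoc a b μ ν []            = []
  ·ₜ-assoc a b μ ν ((x , κ) ∷ q) =
    (sym (*-assoc a b x) , ≡.sym (zipWith-assoc Nat.+-assoc μ ν κ)) ∷ ·ₜ-assoc a b μ ν q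

  ·ₜ-*ₚ : ∀ {n} (t : Term n) r q → Pointwise _≈ₜ_ (t ·ₜ (r *ₚ q)) ((t ·ₜ r) *ₚ q)
  ·ₜ-*ₚ t             []            q = []
  ·ₜ-*ₚ t@(a , μ) ((b , ν) ∷ r) q =
    subst (λ z → Pointwise _≈ₜ_ z ((t ·ₜ ((b , ν) ∷ r)) *ₚ q))
          (≡.sym (L.map-++ _ ((b , ν) ·ₜ q) (r *ₚ q)))
      (Pointwise.++⁺ (·ₜ-assoc a b μ ν q) (·ₜ-*ₚ t r q))

  *ₚ-assoc : ∀ {n} (r r′ q : Poly n) → Pointwise _≈ₜ_ (r *ₚ (r′ *ₚ q)) ((r *ₚ r′) *ₚ q)
  *ₚ-assoc []      r′ q = []
  *ₚ-assoc (t ∷ r) r′ q =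
    subst (Pointwise _≈ₜ_ _) (≡.sym (*ₚ-distribʳ (t ·ₜ r′) (r *ₚ r′) q))
      (Pointwise.++⁺ (·ₜ-*ₚ t r′ q) (*ₚ-assoc r r′ q))

  module _ {n g} {G : Poly n → Set g} where

    ⟨⟩-++ : ∀ {p q} → ⟨ G ⟩ p → ⟨ G ⟩ q → ⟨ G ⟩ (p L.++ q)
    ⟨⟩-++ {p} p∈ zero-∈                 = subst ⟨ G ⟩ (≡.sym (L.++-identityʳ p)) p∈
    ⟨⟩-++ {p} p∈ (add-∈ {q} q∈ r h Gh)  =
      subst ⟨ G ⟩ (L.++-assoc p q (r *ₚ h)) (add-∈ (⟨⟩-++ p∈ q∈) r h Gh)
    ⟨⟩-++ {p} p∈ (resp-∈ {q} {q′} q≋q′ q∈) =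
      resp-∈ (++-cong p p q q′ (λ _ → ≈-refl) q≋q′) (⟨⟩-++ p∈ q∈)

    ⟨⟩-*ₚ : ∀ {q} → ⟨ G ⟩ q → ∀ r → ⟨ G ⟩ (r *ₚ q)
    ⟨⟩-*ₚ zero-∈                    r = subst ⟨ G ⟩ (≡.sym (*ₚ-zeroʳ r)) zero-∈
    ⟨⟩-*ₚ (add-∈ {p} p∈ r′ h Gh)    r = resp-∈ reassociate (add-∈ (⟨⟩-*ₚ p∈ r) (r *ₚ r′) h Gh)
      where
      open ≋-Reasoning
      reassociate : (r *ₚ p L.++ (r *ₚ r′) *ₚ h) ≋ (r *ₚ (p L.++ r′ *ₚ h))
      reassociate = begin
        r *ₚ p L.++ (r *ₚ r′) *ₚ h
          ≈⟨ ++-cong (r *ₚ p) (r *ₚ p) _ _ (λ _ → ≈-refl) (Pointwise⇒≋ (*ₚ-assoc r r′ h)) ⟨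
        r *ₚ p L.++ r *ₚ (r′ *ₚ h)   ≈⟨ *ₚ-distribˡ r p (r′ *ₚ h) ⟨
        r *ₚ (p L.++ r′ *ₚ h)        ∎
    ⟨⟩-*ₚ (resp-∈ {q} {q′} q≋q′ q∈) r = resp-∈ (*ₚ-congˡ r q q′ q≋q′) (⟨⟩-*ₚ q∈ r)

    ⊆⟨⟩ : ∀ {p} → G p → ⟨ G ⟩ p
    ⊆⟨⟩ {p} Gp = resp-∈ one*p≋p (add-∈ zero-∈ ((1# , replicate n 0) ∷ []) p Gp)
      where
      open ≋-Reasoning
      one*p≋p : ((1# , replicate n 0) ·ₜ p L.++ []) ≋ p
      one*p≋p = begin
        (1# , replicate n 0) ·ₜ p L.++ [] ≡⟨ L.++-identityʳ _ ⟩
        (1# , replicate n 0) ·ₜ p         ≈⟨ Pointwise⇒≋ (·ₜ-identityˡ p) ⟩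
        p                                 ∎

    ⟨⟩-least : ∀ {h} {H : Poly n → Set h} → (∀ {p} → H p → ⟨ G ⟩ p) → ∀ {q} → ⟨ H ⟩ q → ⟨ G ⟩ q
    ⟨⟩-least H⊆ zero-∈               = zero-∈
    ⟨⟩-least H⊆ (add-∈ p∈ r h Hh)    = ⟨⟩-++ (⟨⟩-least H⊆ p∈) (⟨⟩-*ₚ (H⊆ Hh) r)
    ⟨⟩-least H⊆ (resp-∈ p≋q p∈)      = resp-∈ p≋q (⟨⟩-least H⊆ p∈)

  module _ {m n} {f : Monomial m → Monomial n} (g : Monomial n → Monomial m) (g∘f : ∀ μ → g (f μ) ≡ μ)
           (f-+ᵐ : ∀ μ ν → f (μ +ᵐ ν) ≡ f μ +ᵐ f ν) where

    mapPoly-·ₜ : ∀ a μ q → mapPoly f ((a , μ) ·ₜ q) ≡ (a , f μ) ·ₜ mapPoly f q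
    mapPoly-·ₜ a μ []            = refl
    mapPoly-·ₜ a μ ((b , ν) ∷ q) = ≡.cong₂ _∷_ (cong (a * b ,_) (f-+ᵐ μ ν)) (mapPoly-·ₜ a μ q)

    mapPoly-*ₚ : ∀ r q → mapPoly f (r *ₚ q) ≡ mapPoly f r *ₚ mapPoly f q
    mapPoly-*ₚ []            q = refl
    mapPoly-*ₚ ((a , μ) ∷ r) q = begin
      mapPoly f ((a , μ) ·ₜ q L.++ r *ₚ q)
        ≡⟨ L.map-++ _ ((a , μ) ·ₜ q) (r *ₚ q) ⟩
      mapPoly f ((a , μ) ·ₜ q) L.++ mapPoly f (r *ₚ q)
        ≡⟨ ≡.cong₂ L._++_ (mapPoly-·ₜ a μ q) (mapPoly-*ₚ r q) ⟩
      (a , f μ) ·ₜ mapPoly f q L.++ mapPoly f r *ₚ mapPoly f q ∎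
      where open ≡.≡-Reasoning

    mapPoly-⟨⟩ : ∀ {g₁ g₂} {G : Poly m → Set g₁} {G′ : Poly n → Set g₂} →
      (∀ {q} → G q → ⟨ G′ ⟩ (mapPoly f q)) → ∀ {q} → ⟨ G ⟩ q → ⟨ G′ ⟩ (mapPoly f q)
    mapPoly-⟨⟩ G↦G′ zero-∈ = zero-∈
    mapPoly-⟨⟩ {G′ = G′} G↦G′ (add-∈ {p} p∈ r q Gq) =
      subst ⟨ G′ ⟩ (≡.sym (≡.trans (L.map-++ _ p (r *ₚ q)) (cong (mapPoly f p L.++_) (mapPoly-*ₚ r q))))
        (⟨⟩-++ (mapPoly-⟨⟩ G↦G′ p∈) (⟨⟩-*ₚ (G↦G′ Gq) (mapPoly f r)))
    mapPoly-⟨⟩ G↦G′ (resp-∈ {p} {q} p≋q p∈) =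
      resp-∈ (mapTerms-cong g (λ x≈y → x≈y) (λ _ _ → ≈-refl) ≈-refl g∘f p q p≋q) (mapPoly-⟨⟩ G↦G′ p∈)

  monomial*binom : ∀ {n} (μ α β : Monomial n) → (((1# , μ) ∷ []) *ₚ binom α β) ≋ binom (μ +ᵐ α) (μ +ᵐ β)
  monomial*binom μ α β =
    Pointwise⇒≋ {q = binom (μ +ᵐ α) (μ +ᵐ β)}
      ((*-identityˡ 1# , refl) ∷ (*-identityˡ (- 1#) , refl) ∷ [])

  binom-telescope : ∀ {n} (α β γ : Monomial n) → (binom α β L.++ binom β γ) ≋ binom α γ
  binom-telescope α β γ = ∷-cong (1# , α) (∷-∷-cancel β ((- 1# , γ) ∷ []) (-‿inverseˡ 1#))

  SumsetBinomial : ∀ {n} → Vec FS n → Poly n → Set c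
  SumsetBinomial As p = ∃[ α ] ∃[ β ] (lincomb α As ≃ₛ lincomb β As × p ≡ binom α β)

  module _ {s t : ℕ} where

    inclˡ-+ᵐ : ∀ (μ ν : Monomial s) → inclˡ t (μ +ᵐ ν) ≡ inclˡ t μ +ᵐ inclˡ t ν
    inclˡ-+ᵐ μ ν = ≡.sym (≡.trans (zipWith-++ Nat._+_ μ (replicate t 0) ν (replicate t 0))
                                 (cong (μ +ᵐ ν ++_) (zipWith-identityˡ Nat.+-identityˡ (replicate t 0))))

    inclʳ-+ᵐ : ∀ (μ ν : Monomial t) → inclʳ s (μ +ᵐ ν) ≡ inclʳ s μ +ᵐ inclʳ s ν
    inclʳ-+ᵐ μ ν = ≡.sym (≡.trans (zipWith-++ Nat._+_ (replicate s 0) μ (replicate s 0) ν)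
                                 (cong (_++ μ +ᵐ ν) (zipWith-identityˡ Nat.+-identityˡ (replicate s 0))))

    take-inclˡ : ∀ (μ : Monomial s) → V.take s (inclˡ t μ) ≡ μ
    take-inclˡ μ = ++-injectiveˡ (V.take s (inclˡ t μ)) μ (take++drop≡id s (inclˡ t μ))

    drop-inclʳ : ∀ (μ : Monomial t) → V.drop s (inclʳ s μ) ≡ μ
    drop-inclʳ μ = ++-injectiveʳ (V.take s (inclʳ s μ)) (replicate s 0) (take++drop≡id s (inclʳ s μ))

    inclˡ-+ᵐ-inclʳ : ∀ (μ : Monomial s) (ν : Monomial t) → inclˡ t μ +ᵐ inclʳ s ν ≡ μ ++ ν
    inclˡ-+ᵐ-inclʳ μ ν = ≡.trans (zipWith-++ Nat._+_ μ (replicate t 0) (replicate s 0) ν)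
      (≡.cong₂ _++_ (zipWith-identityʳ Nat.+-identityʳ μ) (zipWith-identityˡ Nat.+-identityˡ ν))

    inclʳ-+ᵐ-inclˡ : ∀ (μ : Monomial s) (ν : Monomial t) → inclʳ s ν +ᵐ inclˡ t μ ≡ μ ++ ν
    inclʳ-+ᵐ-inclˡ μ ν = ≡.trans (zipWith-++ Nat._+_ (replicate s 0) ν μ (replicate t 0))
      (≡.cong₂ _++_ (zipWith-identityˡ Nat.+-identityˡ μ) (zipWith-identityʳ Nat.+-identityʳ ν))

    binom-++-decomposition : ∀ (α₁ β₁ : Monomial s) (α₂ β₂ : Monomial t) →
      (((1# , inclʳ s α₂) ∷ []) *ₚ binom (inclˡ t α₁) (inclˡ t β₁)
        L.++ ((1# , inclˡ t β₁) ∷ []) *ₚ binom (inclʳ s α₂) (inclʳ s β₂))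
      ≋ binom (α₁ ++ α₂) (β₁ ++ β₂)
    binom-++-decomposition α₁ β₁ α₂ β₂ = begin
      ((1# , u) ∷ []) *ₚ X L.++ ((1# , v) ∷ []) *ₚ Y
        ≈⟨ ++-cong (((1# , u) ∷ []) *ₚ X) (binom (u +ᵐ inclˡ t α₁) (u +ᵐ inclˡ t β₁))
                   (((1# , v) ∷ []) *ₚ Y) (binom (v +ᵐ inclʳ s α₂) (v +ᵐ inclʳ s β₂))
                   (monomial*binom u _ _) (monomial*binom v _ _) ⟩
      binom (u +ᵐ inclˡ t α₁) (u +ᵐ inclˡ t β₁) L.++ binom (v +ᵐ inclʳ s α₂) (v +ᵐ inclʳ s β₂)
        ≡⟨ ≡.cong₂ L._++_ (≡.cong₂ binom (inclʳ-+ᵐ-inclˡ α₁ α₂) (inclʳ-+ᵐ-inclˡ β₁ α₂))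
                          (≡.cong₂ binom (inclˡ-+ᵐ-inclʳ β₁ α₂) (inclˡ-+ᵐ-inclʳ β₁ β₂)) ⟩
      binom (α₁ ++ α₂) (β₁ ++ α₂) L.++ binom (β₁ ++ α₂) (β₁ ++ β₂)
        ≈⟨ binom-telescope (α₁ ++ α₂) (β₁ ++ α₂) (β₁ ++ β₂) ⟩
      binom (α₁ ++ α₂) (β₁ ++ β₂) ∎
      where
      open ≋-Reasoning
      u = inclʳ s α₂
      v = inclˡ t β₁
      X = binom (inclˡ t α₁) (inclˡ t β₁)
      Y = binom (inclʳ s α₂) (inclʳ s β₂)

    extendˡ⊆ : ∀ (As : Vec FS s) (Bs : Vec FS t) {p} →
      extend (inclˡ t) (sumsetIdeal As) p → sumsetIdeal (As ++ Bs) p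
    extendˡ⊆ As Bs =
      ⟨⟩-least λ { (q , q∈ , refl) → mapPoly-⟨⟩ (V.take s) take-inclˡ inclˡ-+ᵐ (⊆⟨⟩ ∘ shift) q∈ }
      where
      shift : ∀ {q} → SumsetBinomial As q → SumsetBinomial (As ++ Bs) (mapPoly (inclˡ t) q)
      shift (α , β , α≃β , refl) =
        inclˡ t α , inclˡ t β , lincomb-++-cong α β 0ₜ 0ₜ As Bs α≃β (≃ₛ-refl {lincomb 0ₜ Bs}) , refl
        where 0ₜ = replicate t 0

    extendʳ⊆ : ∀ (As : Vec FS s) (Bs : Vec FS t) {p} →
      extend (inclʳ s) (sumsetIdeal Bs) p → sumsetIdeal (As ++ Bs) p
    extendʳ⊆ As Bs =
      ⟨⟩-least λ { (q , q∈ , refl) → mapPoly-⟨⟩ (V.drop s) drop-inclʳ inclʳ-+ᵐ (⊆⟨⟩ ∘ shift) q∈ }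
      where
      shift : ∀ {q} → SumsetBinomial Bs q → SumsetBinomial (As ++ Bs) (mapPoly (inclʳ s) q)
      shift (α , β , α≃β , refl) =
        inclʳ s α , inclʳ s β , lincomb-++-cong 0ₛ 0ₛ α β As Bs (≃ₛ-refl {lincomb 0ₛ As}) α≃β , refl
        where 0ₛ = replicate s 0

    extend⊞extend⊆ : ∀ (As : Vec FS s) (Bs : Vec FS t) {p} →
      (extend (inclˡ t) (sumsetIdeal As) ⊞ extend (inclʳ s) (sumsetIdeal Bs)) p →
      sumsetIdeal (As ++ Bs) p
    extend⊞extend⊆ As Bs = ⟨⟩-least λ { (inj₁ p∈) → extendˡ⊆ As Bs p∈ ; (inj₂ p∈) → extendʳ⊆ As Bs p∈ }

    SumsetBinomial⊆extend⊞extend : ∀ (a : Vec ℕ s) {Ã : Vec FS t} → All (λ A → minFS A ≡ 0) Ã →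
      ∀ {p} → SumsetBinomial (map [_] a ++ Ã) p →
      (extend (inclˡ t) (sumsetIdeal (map [_] a)) ⊞ extend (inclʳ s) (sumsetIdeal Ã)) p
    SumsetBinomial⊆extend⊞extend a {Ã} mins (α , β , α≃β , refl)
      with α₁ , α₂ , refl ← V.splitAt s α | β₁ , β₂ , refl ← V.splitAt s β
      with α₁≃β₁ , α₂≃β₂ ← lincomb-split a mins α₁ β₁ α≃β =
      resp-∈ (binom-++-decomposition α₁ β₁ α₂ β₂)
        (⟨⟩-++ (⟨⟩-*ₚ (⊆⟨⟩ (inj₁ x-part)) ((1# , inclʳ s α₂) ∷ []))
               (⟨⟩-*ₚ (⊆⟨⟩ (inj₂ y-part)) ((1# , inclˡ t β₁) ∷ [])))
      where
      x-part : extend (inclˡ t) (sumsetIdeal (map [_] a)) (mapPoly (inclˡ t) (binom α₁ β₁))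
      x-part = ⊆⟨⟩ (binom α₁ β₁ , ⊆⟨⟩ (α₁ , β₁ , α₁≃β₁ , refl) , refl)
      y-part : extend (inclʳ s) (sumsetIdeal Ã) (mapPoly (inclʳ s) (binom α₂ β₂))
      y-part = ⊆⟨⟩ (binom α₂ β₂ , ⊆⟨⟩ (α₂ , β₂ , α₂≃β₂ , refl) , refl)

proposition5 : ∀ {c ℓ : Level} (k : Field c ℓ) (s t : ℕ)
    (a : Vec ℕ s) (Ã : Vec FS t) →
    All NonZero a →
    All (λ A → minFS A ≡ 0) Ã →
    let open Polynomials k in
    sumsetIdeal (map [_] a ++ Ã)
    ≐ (extend (inclˡ t) (sumsetIdeal (map [_] a)) ⊞ extend (inclʳ s) (sumsetIdeal Ã))
-- The aᵢ need not be non-zero for this argument.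
proposition5 k s t a Ã _ mins p =
  ⟨⟩-least (SumsetBinomial⊆extend⊞extend a mins) , extend⊞extend⊆ (map [_] a) Ã
  where open PolynomialIdeals k
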